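{- For every $n\in\mathbb{N}$, \[ \sum_{\substack{a=1\\ (a,n)=1}}^{n}(a-1,n)_*=\prod_{p^\nu\,\|\, n}\left(2p^{\nu}-p^{\nu-1}-1\right), \] the product being over the prime powers $p^\nu$ with $p^\nu\mid n$ and $p^{\nu+1}\nmid n$.
   Context: $(a,n)$ is the greatest common divisor. For an integer $a$ and $n\in\mathbb{N}$, $(a,n)_*$ denotes the greatest divisor $d$ of $a$ which is a unitary divisor of $n$, i.e. $d\mid n$ and $(d,n/d)=1$ (so $(0,n)_*=n$). -}

module Defs where

open import Data.Nat using (ℕ; zero; suc; _+_; _*_; _∸_; _^_; _⊔_; _≤_)
open import Data.Nat.Divisibility using (_∣_; _∣?_)
open import Data.Nat.GCD using (gcd)
open import Data.Nat.DivMod using (_/_)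
open import Data.Nat.Primality using (Prime; prime?)
open import Data.Nat.Properties using (_≟_)
open import Data.List using (List; []; _∷_; map; filter; concatMap; foldr)
open import Data.Nat.ListAction using (sum; product)
open import Data.Product using (_×_; _,_)
open import Relation.Nullary using (¬_; Dec)
open import Relation.Binary.PropositionalEquality using (_≡_)
open import Relation.Nullary.Decidable using (_×-dec_; ¬?)

range1 : ℕ → List ℕ
range1 zero = []
range1 (suc n) = range1 n Data.List.++ (suc n ∷ [])

-- d is a unitary divisor of n : d ∣ n and (d , n/d) = 1   (for n ≥ 1, so d ≥ 1)
-- (division n / d written with divisor suc (d ∸ 1) = d for d ≥ 1, to avoid a NonZero side condition)
UnitaryDivisor : ℕ → ℕ → Set
UnitaryDivisor d n = d ∣ n × gcd d (n / suc (d ∸ 1)) ≡ 1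

unitaryDivisor? : (d n : ℕ) → Dec (UnitaryDivisor d n)
unitaryDivisor? d n = d ∣? n ×-dec (gcd d (n / suc (d ∸ 1)) ≟ 1)

-- (a , n)_* : the greatest divisor d of a which is a unitary divisor of n.
-- Every such d (n ≥ 1) lies in [1 .. n]; we take the maximum over that range.
unitaryGcd : ℕ → ℕ → ℕ
unitaryGcd a n =
  foldr _⊔_ 0 (filter (λ d → d ∣? a ×-dec unitaryDivisor? d n) (range1 n))

lhs : ℕ → ℕ
lhs n = sum (map (λ a → unitaryGcd (a ∸ 1) n) (filter (λ a → gcd a n ≟ 1) (range1 n)))

-- Prime powers p^ν exactly dividing n (ν ≥ 1): pairs (p , ν) with p prime,
-- p^ν ∣ n and ¬ p^(ν+1) ∣ n; p and ν range over [1 .. n] (sufficient for n ≥ 1).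
exactPrimePowers : ℕ → List (ℕ × ℕ)
exactPrimePowers n =
  concatMap (λ p → map (λ ν → p , ν)
    (filter (λ ν → (p ^ ν) ∣? n ×-dec ¬? ((p ^ suc ν) ∣? n)) (range1 n)))
    (filter prime? (range1 n))

rhs : ℕ → ℕ
rhs n = product (map (λ { (p , ν) → 2 * p ^ ν ∸ p ^ (ν ∸ 1) ∸ 1 }) (exactPrimePowers n))

-- Both sides are multiplicative. Write the left-hand side as ∑_{i<n} T_n(i) with
-- T_n(i) = [gcd(i+1, n) = 1] · (i, n)_*. For coprime m and k, T_{mk} = T_m · T_k, since a
-- unitary divisor of mk splits uniquely into unitary divisors of m and of k; moreover T_m and
-- T_k are periodic with periods m and k, and j ↦ jm + b permutes the residues modulo k, so
-- the sum over i < mk factors into the two sums. For N = p^ν the only unitary divisors are 1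
-- and N, so a = 1 contributes N and every other a prime to p contributes 1, giving
-- N + (N − N/p − 1). On the right-hand side the factor belonging to p does not change when n
-- is multiplied by a number prime to p. Splitting off the full power of a prime factor then
-- gives the theorem by induction on n.

module Submission where

open import Data.Empty using (⊥-elim)
open import Data.List using (List; []; _∷_; _++_; map; filter; concatMap; foldr)
open import Data.List.Properties using (map-++; filter-++; map-∘; map-cong; foldr-preservesᵒ)
open import Data.List.Membership.Propositional using (_∈_)
open import Data.List.Membership.Propositional.Properties
  using (∈-++⁺ˡ; ∈-++⁺ʳ; ∈-filter⁺; ∈-filter⁻; foldr-selective)
open import Data.List.Relation.Unary.All using (_∷_)
open import Data.List.Relation.Unary.Any as Any using (here)
open import Data.Nat
open import Data.Nat.Properties
open import Data.Nat.Coprimality using (Coprime; coprime-divisor; gcd≡1⇒coprime; coprime⇒gcd≡1)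
  renaming (sym to coprime-sym)
open import Data.Nat.Divisibility
open import Data.Nat.DivMod using (m*n/n≡m; m≡m%n+[m/n]*n; m%n<n)
open import Data.Nat.GCD
open import Data.Nat.Induction using (<-rec)
open import Data.Nat.ListAction using (sum; product)
open import Data.Nat.ListAction.Properties using (sum-++; product-++)
open import Data.Nat.Primality
open import Data.Nat.Primality.Factorisation using (factorise)
open import Data.Nat.Solver using (module +-*-Solver)
open import Data.Product using (Σ-syntax; _×_; _,_; proj₁; proj₂)
open import Data.Sum using (_⊎_; inj₁; inj₂)
open import Function using (_∘_)
open import Relation.Binary.Definitions using (tri<; tri≈; tri>)
open import Relation.Binary.PropositionalEquality
open import Relation.Nullary using (Dec; yes; no; ¬_)
open import Relation.Nullary.Decidable using (_×-dec_; ¬?)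

open import Algebra.Properties.CommutativeSemigroup +-commutativeSemigroup
  using () renaming (interchange to +-interchange)
open import Algebra.Properties.CommutativeSemigroup *-commutativeSemigroup
  using () renaming (interchange to *-interchange)

open import Defs

indicator : {A : Set} → Dec A → ℕ
indicator (yes _) = 1
indicator (no _)  = 0

indicator-yes : {A : Set} → A → (d : Dec A) → indicator d ≡ 1
indicator-yes a (yes _) = refl
indicator-yes a (no ¬a) = ⊥-elim (¬a a)

indicator-no : {A : Set} → ¬ A → (d : Dec A) → indicator d ≡ 0
indicator-no ¬a (yes a) = ⊥-elim (¬a a)
indicator-no ¬a (no _)  = refl

indicator-cong : {A B : Set} → (A → B) → (B → A) → (d : Dec A) (e : Dec B) → indicator d ≡ indicator e
indicator-cong f g (yes a) e = sym (indicator-yes (f a) e)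
indicator-cong f g (no ¬a) e = sym (indicator-no (λ b → ¬a (g b)) e)

∑ : ℕ → (ℕ → ℕ) → ℕ
∑ zero    f = 0
∑ (suc n) f = ∑ n f + f n

∏ : ℕ → (ℕ → ℕ) → ℕ
∏ zero    f = 1
∏ (suc n) f = ∏ n f * f n

∑-cong : ∀ n {f g : ℕ → ℕ} → (∀ i → i < n → f i ≡ g i) → ∑ n f ≡ ∑ n g
∑-cong zero    eq = refl
∑-cong (suc n) eq = cong₂ _+_ (∑-cong n (λ i i<n → eq i (m<n⇒m<1+n i<n))) (eq n ≤-refl)

∏-cong : ∀ n {f g : ℕ → ℕ} → (∀ i → i < n → f i ≡ g i) → ∏ n f ≡ ∏ n g
∏-cong zero    eq = refl
∏-cong (suc n) eq = cong₂ _*_ (∏-cong n (λ i i<n → eq i (m<n⇒m<1+n i<n))) (eq n ≤-refl)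

∑-zero : ∀ n f → (∀ i → i < n → f i ≡ 0) → ∑ n f ≡ 0
∑-zero zero    f f≡0 = refl
∑-zero (suc n) f f≡0 = cong₂ _+_ (∑-zero n f (λ i i<n → f≡0 i (m<n⇒m<1+n i<n))) (f≡0 n ≤-refl)

∑-const : ∀ n c → ∑ n (λ _ → c) ≡ n * c
∑-const zero    c = refl
∑-const (suc n) c = trans (cong (_+ c) (∑-const n c)) (+-comm (n * c) c)

∑-head : ∀ n f → ∑ (suc n) f ≡ f 0 + ∑ n (λ i → f (suc i))
∑-head zero    f = sym (+-identityʳ (f 0))
∑-head (suc n) f = trans (cong (_+ f (suc n)) (∑-head n f)) (+-assoc (f 0) _ _)

∑-head′ : ∀ n .{{_ : NonZero n}} f → ∑ n f ≡ f 0 + ∑ (n ∸ 1) (λ i → f (suc i))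
∑-head′ (suc n) f = ∑-head n f

∑-rotate : ∀ n f → ∑ n (λ i → f (suc i)) + f 0 ≡ ∑ n f + f n
∑-rotate n f = trans (+-comm _ (f 0)) (sym (∑-head n f))

<∸1⇒1+< : ∀ {i} n → i < n ∸ 1 → suc i < n
<∸1⇒1+< (suc n) i<n = s<s i<n

∑-+ : ∀ a b f → ∑ (a + b) f ≡ ∑ a f + ∑ b (λ i → f (a + i))
∑-+ a zero    f = trans (cong (λ n → ∑ n f) (+-identityʳ a)) (sym (+-identityʳ _))
∑-+ a (suc b) f = begin
  ∑ (a + suc b) f                                  ≡⟨ cong (λ n → ∑ n f) (+-suc a b) ⟩
  ∑ (a + b) f + f (a + b)                          ≡⟨ cong (_+ f (a + b)) (∑-+ a b f) ⟩
  ∑ a f + ∑ b (λ i → f (a + i)) + f (a + b)        ≡⟨ +-assoc (∑ a f) _ _ ⟩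
  ∑ a f + ∑ (suc b) (λ i → f (a + i))              ∎
  where open ≡-Reasoning

∑-blocks : ∀ k m f → ∑ (k * m) f ≡ ∑ k (λ j → ∑ m (λ b → f (j * m + b)))
∑-blocks zero    m f = refl
∑-blocks (suc k) m f = begin
  ∑ (m + k * m) f                                  ≡⟨ cong (λ n → ∑ n f) (+-comm m (k * m)) ⟩
  ∑ (k * m + m) f                                  ≡⟨ ∑-+ (k * m) m f ⟩
  ∑ (k * m) f + ∑ m (λ b → f (k * m + b))          ≡⟨ cong (_+ ∑ m (λ b → f (k * m + b))) (∑-blocks k m f) ⟩
  ∑ (suc k) (λ j → ∑ m (λ b → f (j * m + b)))      ∎
  where open ≡-Reasoning

*-distribˡ-∑ : ∀ n c f → c * ∑ n f ≡ ∑ n (λ i → c * f i)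
*-distribˡ-∑ zero    c f = *-zeroʳ c
*-distribˡ-∑ (suc n) c f = trans (*-distribˡ-+ c (∑ n f) (f n)) (cong (_+ c * f n) (*-distribˡ-∑ n c f))

*-distribʳ-∑ : ∀ n c f → ∑ n f * c ≡ ∑ n (λ i → f i * c)
*-distribʳ-∑ n c f = trans (*-comm (∑ n f) c)
  (trans (*-distribˡ-∑ n c f) (∑-cong n (λ i _ → *-comm c (f i))))

∑-distrib-+ : ∀ n f g → ∑ n (λ i → f i + g i) ≡ ∑ n f + ∑ n g
∑-distrib-+ zero    f g = refl
∑-distrib-+ (suc n) f g =
  trans (cong (_+ (f n + g n)) (∑-distrib-+ n f g)) (+-interchange (∑ n f) (∑ n g) (f n) (g n))

∑-comm : ∀ n m (f : ℕ → ℕ → ℕ) → ∑ n (λ i → ∑ m (f i)) ≡ ∑ m (λ j → ∑ n (λ i → f i j))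
∑-comm zero    m f = sym (∑-zero m (λ _ → 0) (λ _ _ → refl))
∑-comm (suc n) m f = trans (cong (_+ ∑ m (f n)) (∑-comm n m f))
                           (sym (∑-distrib-+ m (λ j → ∑ n (λ i → f i j)) (f n)))

∑-mono-≤ : ∀ n {f g : ℕ → ℕ} → (∀ i → i < n → f i ≤ g i) → ∑ n f ≤ ∑ n g
∑-mono-≤ zero    f≤g = z≤n
∑-mono-≤ (suc n) f≤g = +-mono-≤ (∑-mono-≤ n (λ i i<n → f≤g i (m<n⇒m<1+n i<n))) (f≤g n ≤-refl)

∑-mono-< : ∀ n {f g : ℕ → ℕ} → (∀ i → i < n → f i ≤ g i) →
           ∀ c → c < n → f c < g c → ∑ n f < ∑ n g
∑-mono-< (suc n) f≤g c c<n fc<gc with c ≟ n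
... | yes refl = +-mono-≤-< (∑-mono-≤ n (λ i i<n → f≤g i (m<n⇒m<1+n i<n))) fc<gc
... | no c≢n   = +-mono-<-≤
  (∑-mono-< n (λ i i<n → f≤g i (m<n⇒m<1+n i<n)) c (≤∧≢⇒< (s≤s⁻¹ c<n) c≢n) fc<gc) (f≤g n ≤-refl)

∑≡n⇒all≡1 : ∀ n f → (∀ i → i < n → f i ≤ 1) → ∑ n f ≡ n → ∀ c → c < n → f c ≡ 1
∑≡n⇒all≡1 n f f≤1 ∑f≡n c c<n with f c in fc
... | suc zero    = refl
... | suc (suc _) = ⊥-elim (≤⇒≯ (f≤1 c c<n) (subst (1 <_) (sym fc) (s≤s z<s)))
... | zero        = ⊥-elim (<-irrefl ∑f≡n (subst (∑ n f <_) (trans (∑-const n 1) (*-identityʳ n))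
                      (∑-mono-< n f≤1 c c<n (subst (_< 1) (sym fc) z<s))))

∑-indicator-≟ : ∀ n x (H : ℕ → ℕ) → x < n → ∑ n (λ c → indicator (x ≟ c) * H c) ≡ H x
∑-indicator-≟ (suc n) x H x<n with x ≟ n
... | yes refl = cong₂ _+_
  (∑-zero n _ (λ c c<n → cong (_* H c) (indicator-no (λ x≡c → <-irrefl (sym x≡c) c<n) (x ≟ c))))
  (*-identityˡ (H x))
... | no x≢n   = trans (+-identityʳ _) (∑-indicator-≟ n x H (≤∧≢⇒< (s≤s⁻¹ x<n) x≢n))

∑-indicator≤1 : ∀ n {A : ℕ → Set} (A? : ∀ i → Dec (A i)) →
                (∀ i j → i < n → j < n → A i → A j → i ≡ j) → ∑ n (λ i → indicator (A? i)) ≤ 1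
∑-indicator≤1 zero    A? unique = z≤n
∑-indicator≤1 (suc n) A? unique with A? n
... | yes a = ≤-reflexive (cong (_+ 1) (∑-zero n _ (λ i i<n →
                indicator-no (λ ai → <-irrefl (unique i n (m<n⇒m<1+n i<n) ≤-refl ai a) i<n) (A? i))))
... | no _  = subst (_≤ 1) (sym (+-identityʳ _))
                (∑-indicator≤1 n A? (λ i j i<n j<n → unique i j (m<n⇒m<1+n i<n) (m<n⇒m<1+n j<n)))

-- Every c < k has exactly one preimage under σ: at most one by injectivity, and the
-- preimage counts add up to k.
∑-reindex : ∀ k (σ H : ℕ → ℕ) → (∀ i → i < k → σ i < k) →
            (∀ i j → i < k → j < k → σ i ≡ σ j → i ≡ j) → ∑ k (λ i → H (σ i)) ≡ ∑ k H
∑-reindex k σ H σ<k σ-injective = begin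
  ∑ k (λ i → H (σ i))
    ≡⟨ ∑-cong k (λ i i<k → sym (∑-indicator-≟ k (σ i) H (σ<k i i<k))) ⟩
  ∑ k (λ i → ∑ k (λ c → indicator (σ i ≟ c) * H c))
    ≡⟨ ∑-comm k k (λ i c → indicator (σ i ≟ c) * H c) ⟩
  ∑ k (λ c → ∑ k (λ i → indicator (σ i ≟ c) * H c))
    ≡⟨ ∑-cong k (λ c _ → *-distribʳ-∑ k (H c) (λ i → indicator (σ i ≟ c))) ⟨
  ∑ k (λ c → preimages c * H c)
    ≡⟨ ∑-cong k (λ c c<k → cong (_* H c) (∑≡n⇒all≡1 k preimages preimages≤1 ∑preimages c c<k)) ⟩
  ∑ k (λ c → 1 * H c)
    ≡⟨ ∑-cong k (λ c _ → *-identityˡ (H c)) ⟩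
  ∑ k H
    ∎
  where
  open ≡-Reasoning
  preimages : ℕ → ℕ
  preimages c = ∑ k (λ i → indicator (σ i ≟ c))
  preimages≤1 : ∀ c → c < k → preimages c ≤ 1
  preimages≤1 c _ = ∑-indicator≤1 k (λ i → σ i ≟ c)
    (λ i j i<k j<k σi≡c σj≡c → σ-injective i j i<k j<k (trans σi≡c (sym σj≡c)))
  ∑preimages : ∑ k preimages ≡ k
  ∑preimages = begin
    ∑ k preimages
      ≡⟨ ∑-comm k k (λ i c → indicator (σ i ≟ c)) ⟨
    ∑ k (λ i → ∑ k (λ c → indicator (σ i ≟ c)))
      ≡⟨ ∑-cong k (λ i i<k → trans (∑-cong k (λ c _ → sym (*-identityʳ _)))
                                    (∑-indicator-≟ k (σ i) (λ _ → 1) (σ<k i i<k))) ⟩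
    ∑ k (λ _ → 1)
      ≡⟨ ∑-const k 1 ⟩
    k * 1
      ≡⟨ *-identityʳ k ⟩
    k
      ∎

∏-ones : ∀ n f → (∀ i → i < n → f i ≡ 1) → ∏ n f ≡ 1
∏-ones zero    f f≡1 = refl
∏-ones (suc n) f f≡1 = cong₂ _*_ (∏-ones n f (λ i i<n → f≡1 i (m<n⇒m<1+n i<n))) (f≡1 n ≤-refl)

∏-single : ∀ n f j → j < n → (∀ i → i < n → i ≢ j → f i ≡ 1) → ∏ n f ≡ f j
∏-single (suc n) f j j<n f≡1 with j ≟ n
... | yes refl = trans
  (cong (_* f j) (∏-ones n f (λ i i<n → f≡1 i (m<n⇒m<1+n i<n) (λ i≡j → <-irrefl i≡j i<n))))
  (*-identityˡ (f j))
... | no j≢n   = trans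
  (cong₂ _*_ (∏-single n f j (≤∧≢⇒< (s≤s⁻¹ j<n) j≢n) (λ i i<n → f≡1 i (m<n⇒m<1+n i<n)))
             (f≡1 n ≤-refl (λ n≡j → j≢n (sym n≡j))))
  (*-identityʳ (f j))

∏-distrib-* : ∀ n f g → ∏ n (λ i → f i * g i) ≡ ∏ n f * ∏ n g
∏-distrib-* zero    f g = refl
∏-distrib-* (suc n) f g =
  trans (cong (_* (f n * g n)) (∏-distrib-* n f g)) (*-interchange (∏ n f) (∏ n g) (f n) (g n))

∏-extend : ∀ {m} n f → m ≤ n → (∀ i → m ≤ i → i < n → f i ≡ 1) → ∏ n f ≡ ∏ m f
∏-extend zero    f z≤n f≡1 = refl
∏-extend {m} (suc n) f m≤1+n f≡1 with m ≟ suc n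
... | yes refl  = refl
... | no m≢1+n = trans
  (cong₂ _*_ (∏-extend n f m≤n (λ i m≤i i<n → f≡1 i m≤i (m<n⇒m<1+n i<n))) (f≡1 n m≤n ≤-refl))
  (*-identityʳ (∏ m f))
  where
  m≤n : m ≤ n
  m≤n = s≤s⁻¹ (≤∧≢⇒< m≤1+n m≢1+n)

-- Periodic sequences

Periodic : (ℕ → ℕ) → ℕ → Set
Periodic f m = ∀ x → f (x + m) ≡ f x

periodic-*+ : ∀ {f m} → Periodic f m → ∀ j b → f (j * m + b) ≡ f b
periodic-*+ {f} {m} f-periodic zero    b = refl
periodic-*+ {f} {m} f-periodic (suc j) b = begin
  f (m + j * m + b)   ≡⟨ cong f (trans (+-assoc m (j * m) b) (+-comm m (j * m + b))) ⟩
  f (j * m + b + m)   ≡⟨ f-periodic (j * m + b) ⟩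
  f (j * m + b)       ≡⟨ periodic-*+ f-periodic j b ⟩
  f b                 ∎
  where open ≡-Reasoning

periodic-% : ∀ {f k} .{{_ : NonZero k}} → Periodic f k → ∀ x → f x ≡ f (x % k)
periodic-% {f} {k} f-periodic x = trans (cong f (trans (m≡m%n+[m/n]*n x k) (+-comm (x % k) _)))
                                         (periodic-*+ f-periodic (x / k) (x % k))

∑-periodic : ∀ {f} m k → Periodic f m → ∑ (k * m) f ≡ k * ∑ m f
∑-periodic {f} m k f-periodic = begin
  ∑ (k * m) f                               ≡⟨ ∑-blocks k m f ⟩
  ∑ k (λ j → ∑ m (λ b → f (j * m + b)))     ≡⟨ ∑-cong k (λ j _ → ∑-cong m (λ b _ →
                                                 periodic-*+ f-periodic j b)) ⟩
  ∑ k (λ _ → ∑ m f)                         ≡⟨ ∑-const k (∑ m f) ⟩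
  k * ∑ m f                                 ∎
  where open ≡-Reasoning

%≡%⇒∣∸ : ∀ x y k .{{_ : NonZero k}} → x % k ≡ y % k → k ∣ y ∸ x
%≡%⇒∣∸ x y k x%k≡y%k = divides (y / k ∸ x / k) (begin
  y ∸ x                                     ≡⟨ cong₂ _∸_ (m≡m%n+[m/n]*n y k) (m≡m%n+[m/n]*n x k) ⟩
  (y % k + y / k * k) ∸ (x % k + x / k * k) ≡⟨ cong (λ r → (y % k + y / k * k) ∸ (r + x / k * k)) x%k≡y%k ⟩
  (y % k + y / k * k) ∸ (y % k + x / k * k) ≡⟨ [m+n]∸[m+o]≡n∸o (y % k) _ _ ⟩
  y / k * k ∸ x / k * k                     ≡⟨ *-distribʳ-∸ k (y / k) (x / k) ⟨
  (y / k ∸ x / k) * k                       ∎)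
  where open ≡-Reasoning

progression-%-≢ : ∀ m k b {i j} .{{_ : NonZero k}} → Coprime m k → i < j → j < k →
                  (i * m + b) % k ≢ (j * m + b) % k
progression-%-≢ m k b {i} {j} m⊥k i<j j<k eq =
  <⇒≱ (≤-<-trans (m∸n≤m j i) j<k) (∣⇒≤ {{>-nonZero (m<n⇒0<n∸m i<j)}} k∣j∸i)
  where
  difference : (j * m + b) ∸ (i * m + b) ≡ m * (j ∸ i)
  difference = begin
    (j * m + b) ∸ (i * m + b) ≡⟨ cong₂ _∸_ (+-comm (j * m) b) (+-comm (i * m) b) ⟩
    (b + j * m) ∸ (b + i * m) ≡⟨ [m+n]∸[m+o]≡n∸o b (j * m) (i * m) ⟩
    j * m ∸ i * m             ≡⟨ *-distribʳ-∸ m j i ⟨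
    (j ∸ i) * m               ≡⟨ *-comm (j ∸ i) m ⟩
    m * (j ∸ i)               ∎
    where open ≡-Reasoning
  k∣j∸i : k ∣ j ∸ i
  k∣j∸i = coprime-divisor (coprime-sym m⊥k) (subst (k ∣_) difference (%≡%⇒∣∸ (i * m + b) (j * m + b) k eq))

∑-progression : ∀ {H} m k b .{{_ : NonZero k}} → Coprime m k → Periodic H k →
                ∑ k (λ j → H (j * m + b)) ≡ ∑ k H
∑-progression {H} m k b m⊥k H-periodic =
  trans (∑-cong k (λ j _ → periodic-% H-periodic (j * m + b)))
        (∑-reindex k (λ j → (j * m + b) % k) H (λ j _ → m%n<n (j * m + b) k) injective)
  where
  injective : ∀ i j → i < k → j < k → (i * m + b) % k ≡ (j * m + b) % k → i ≡ j
  injective i j i<k j<k eq with <-cmp i j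
  ... | tri< i<j _ _ = ⊥-elim (progression-%-≢ m k b m⊥k i<j j<k eq)
  ... | tri≈ _ i≡j _ = i≡j
  ... | tri> _ _ j<i = ⊥-elim (progression-%-≢ m k b m⊥k j<i i<k (sym eq))

-- The Chinese remainder theorem, in the form of a sum over a complete residue system modulo k * m.
∑-*-periodic : ∀ {G H} m k .{{_ : NonZero k}} → Coprime m k → Periodic G m → Periodic H k →
               ∑ (k * m) (λ a → G a * H a) ≡ ∑ m G * ∑ k H
∑-*-periodic {G} {H} m k m⊥k G-periodic H-periodic = begin
  ∑ (k * m) (λ a → G a * H a)
    ≡⟨ ∑-blocks k m (λ a → G a * H a) ⟩
  ∑ k (λ j → ∑ m (λ b → G (j * m + b) * H (j * m + b)))
    ≡⟨ ∑-cong k (λ j _ → ∑-cong m (λ b _ → cong (_* H (j * m + b)) (periodic-*+ G-periodic j b))) ⟩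
  ∑ k (λ j → ∑ m (λ b → G b * H (j * m + b)))
    ≡⟨ ∑-comm k m (λ j b → G b * H (j * m + b)) ⟩
  ∑ m (λ b → ∑ k (λ j → G b * H (j * m + b)))
    ≡⟨ ∑-cong m (λ b _ → *-distribˡ-∑ k (G b) (λ j → H (j * m + b))) ⟨
  ∑ m (λ b → G b * ∑ k (λ j → H (j * m + b)))
    ≡⟨ ∑-cong m (λ b _ → cong (G b *_) (∑-progression m k b m⊥k H-periodic)) ⟩
  ∑ m (λ b → G b * ∑ k H)
    ≡⟨ *-distribʳ-∑ m (∑ k H) G ⟨
  ∑ m G * ∑ k H
    ∎
  where open ≡-Reasoning

module _ {P : ℕ → Set} (P? : ∀ x → Dec (P x)) (h : ℕ → ℕ) where

  sum-filter-[_] : ∀ x → sum (map h (filter P? (x ∷ []))) ≡ indicator (P? x) * h x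
  sum-filter-[ x ] with P? x
  ... | yes _ = refl
  ... | no _  = refl

  product-filter-[_] : ∀ x → product (map h (filter P? (x ∷ []))) ≡ h x ^ indicator (P? x)
  product-filter-[ x ] with P? x
  ... | yes _ = refl
  ... | no _  = refl

  sum-filter-range1 : ∀ n → sum (map h (filter P? (range1 n))) ≡
                            ∑ n (λ i → indicator (P? (suc i)) * h (suc i))
  sum-filter-range1 zero    = refl
  sum-filter-range1 (suc n) = begin
    sum (map h (filter P? (range1 n ++ suc n ∷ [])))
      ≡⟨ cong (sum ∘ map h) (filter-++ P? (range1 n) (suc n ∷ [])) ⟩
    sum (map h (filter P? (range1 n) ++ filter P? (suc n ∷ [])))
      ≡⟨ cong sum (map-++ h (filter P? (range1 n)) _) ⟩
    sum (map h (filter P? (range1 n)) ++ map h (filter P? (suc n ∷ [])))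
      ≡⟨ sum-++ (map h (filter P? (range1 n))) _ ⟩
    sum (map h (filter P? (range1 n))) + sum (map h (filter P? (suc n ∷ [])))
      ≡⟨ cong₂ _+_ (sum-filter-range1 n) sum-filter-[ suc n ] ⟩
    ∑ (suc n) (λ i → indicator (P? (suc i)) * h (suc i))
      ∎
    where open ≡-Reasoning

  product-filter-range1 : ∀ n → product (map h (filter P? (range1 n))) ≡
                                ∏ n (λ i → h (suc i) ^ indicator (P? (suc i)))
  product-filter-range1 zero    = refl
  product-filter-range1 (suc n) = begin
    product (map h (filter P? (range1 n ++ suc n ∷ [])))
      ≡⟨ cong (product ∘ map h) (filter-++ P? (range1 n) (suc n ∷ [])) ⟩
    product (map h (filter P? (range1 n) ++ filter P? (suc n ∷ [])))
      ≡⟨ cong product (map-++ h (filter P? (range1 n)) _) ⟩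
    product (map h (filter P? (range1 n)) ++ map h (filter P? (suc n ∷ [])))
      ≡⟨ product-++ (map h (filter P? (range1 n))) _ ⟩
    product (map h (filter P? (range1 n))) * product (map h (filter P? (suc n ∷ [])))
      ≡⟨ cong₂ _*_ (product-filter-range1 n) product-filter-[ suc n ] ⟩
    ∏ (suc n) (λ i → h (suc i) ^ indicator (P? (suc i)))
      ∎
    where open ≡-Reasoning

product-concatMap : {A B : Set} (F : B → ℕ) (g : A → List B) (xs : List A) →
                    product (map F (concatMap g xs)) ≡ product (map (λ x → product (map F (g x))) xs)
product-concatMap F g []       = refl
product-concatMap F g (x ∷ xs) = begin
  product (map F (g x ++ concatMap g xs))
    ≡⟨ cong product (map-++ F (g x) (concatMap g xs)) ⟩
  product (map F (g x) ++ map F (concatMap g xs))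
    ≡⟨ product-++ (map F (g x)) _ ⟩
  product (map F (g x)) * product (map F (concatMap g xs))
    ≡⟨ cong (product (map F (g x)) *_) (product-concatMap F g xs) ⟩
  product (map (λ x → product (map F (g x))) (x ∷ xs))
    ∎
  where open ≡-Reasoning

coprime-∣-mono : ∀ {m k a b} → Coprime m k → a ∣ m → b ∣ k → Coprime a b
coprime-∣-mono m⊥k a∣m b∣k (i∣a , i∣b) = m⊥k (∣-trans i∣a a∣m , ∣-trans i∣b b∣k)

coprime-*ˡ : ∀ {a b c} → Coprime a c → Coprime b c → Coprime (a * b) c
coprime-*ˡ a⊥c b⊥c (i∣ab , i∣c) =
  b⊥c (coprime-divisor (coprime-∣-mono (coprime-sym a⊥c) i∣c ∣-refl) i∣ab , i∣c)

coprime-*ʳ : ∀ {a b c} → Coprime c a → Coprime c b → Coprime c (a * b)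
coprime-*ʳ c⊥a c⊥b = coprime-sym (coprime-*ˡ (coprime-sym c⊥a) (coprime-sym c⊥b))

coprime-1ˡ : ∀ {c} → Coprime 1 c
coprime-1ˡ (i∣1 , _) = ∣1⇒≡1 i∣1

coprime-^ˡ : ∀ {a c} i → Coprime a c → Coprime (a ^ i) c
coprime-^ˡ zero    a⊥c = coprime-1ˡ
coprime-^ˡ (suc i) a⊥c = coprime-*ˡ a⊥c (coprime-^ˡ i a⊥c)

coprime-^ʳ : ∀ {a c} i → Coprime c a → Coprime c (a ^ i)
coprime-^ʳ i c⊥a = coprime-sym (coprime-^ˡ i (coprime-sym c⊥a))

coprime⇒*∣ : ∀ {a b x} → Coprime a b → a ∣ x → b ∣ x → a * b ∣ x
coprime⇒*∣ {a} {b} {x} a⊥b (divides q x≡qa) b∣x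
  with coprime-divisor (coprime-sym a⊥b) (subst (b ∣_) (trans x≡qa (*-comm q a)) b∣x)
... | divides r q≡rb = divides r (begin
  x           ≡⟨ x≡qa ⟩
  q * a       ≡⟨ cong (_* a) q≡rb ⟩
  r * b * a   ≡⟨ *-assoc r b a ⟩
  r * (b * a) ≡⟨ cong (r *_) (*-comm b a) ⟩
  r * (a * b) ∎)
  where open ≡-Reasoning

prime≢1 : ∀ {p} → Prime p → p ≢ 1
prime≢1 p-prime = nonTrivial⇒≢1 {{prime⇒nonTrivial p-prime}}

prime>1 : ∀ {p} → Prime p → 1 < p
prime>1 {p} p-prime = nonTrivial⇒n>1 p {{prime⇒nonTrivial p-prime}}

prime∤⇒coprime : ∀ {p d} → Prime p → ¬ p ∣ d → Coprime p d
prime∤⇒coprime p-prime p∤d (i∣p , i∣d) with prime⇒irreducible p-prime i∣p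
... | inj₁ i≡1 = i≡1
... | inj₂ refl = ⊥-elim (p∤d i∣d)

primes-coprime : ∀ {p q} → Prime p → Prime q → p ≢ q → Coprime p q
primes-coprime {p} {q} p-prime q-prime p≢q = prime∤⇒coprime p-prime p∤q
  where
  p∤q : ¬ p ∣ q
  p∤q p∣q with prime⇒irreducible q-prime p∣q
  ... | inj₁ p≡1 = prime≢1 p-prime p≡1
  ... | inj₂ p≡q = p≢q p≡q

∣p^ν⇒p∣ : ∀ {p d} ν → Prime p → d ∣ p ^ ν → d ≢ 1 → p ∣ d
∣p^ν⇒p∣ zero    p-prime d∣1 d≢1 = ⊥-elim (d≢1 (∣1⇒≡1 d∣1))
∣p^ν⇒p∣ {p} {d} (suc ν) p-prime d∣p^ν d≢1 with p ∣? d
... | yes p∣d = p∣d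
... | no  p∤d = ∣p^ν⇒p∣ ν p-prime (coprime-divisor (coprime-sym (prime∤⇒coprime p-prime p∤d)) d∣p^ν) d≢1

n<m^n : ∀ {m} n → 1 < m → n < m ^ n
n<m^n zero    1<m = z<s
n<m^n {m@(suc _)} (suc n) 1<m = begin-strict
  suc n     ≤⟨ n<m^n n 1<m ⟩
  m ^ n     <⟨ m<m*n (m ^ n) m {{m^n≢0 m n}} 1<m ⟩
  m ^ n * m ≡⟨ *-comm (m ^ n) m ⟩
  m * m ^ n ∎
  where open ≤-Reasoning

^-monoʳ-∣ : ∀ q {a b} → a ≤ b → q ^ a ∣ q ^ b
^-monoʳ-∣ q {a} {b} a≤b = divides (q ^ (b ∸ a)) (begin
  q ^ b               ≡⟨ cong (q ^_) (m+[n∸m]≡n a≤b) ⟨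
  q ^ (a + (b ∸ a))   ≡⟨ ^-distribˡ-+-* q a (b ∸ a) ⟩
  q ^ a * q ^ (b ∸ a) ≡⟨ *-comm (q ^ a) _ ⟩
  q ^ (b ∸ a) * q ^ a ∎)
  where open ≡-Reasoning

-- With g = gcd d m and d = g * t, t is coprime to m / g and so divides k.
∣*⇒∣gcd*gcd : ∀ {m k d} .{{_ : NonZero d}} → Coprime m k → d ∣ m * k → d ∣ gcd d m * gcd d k
∣*⇒∣gcd*gcd {m} {k} {d} m⊥k d∣mk with gcd[m,n]∣m d m | gcd[m,n]∣n d m
... | divides t d≡tg | divides m′ m≡m′g = subst (_∣ g * gcd d k) (sym d≡gt) (*-monoʳ-∣ g t∣gcd[d,k])
  where
  g : ℕ
  g = gcd d m
  instance
    g≢0 : NonZero g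
    g≢0 = ≢-nonZero (λ g≡0 → ≢-nonZero⁻¹ d (gcd[m,n]≡0⇒m≡0 g≡0))
  d≡gt : d ≡ g * t
  d≡gt = trans d≡tg (*-comm t g)
  m≡gm′ : m ≡ g * m′
  m≡gm′ = trans m≡m′g (*-comm m′ g)
  t⊥m′ : Coprime t m′
  t⊥m′ = gcd≡1⇒coprime (*-cancelˡ-≡ (gcd t m′) 1 g (begin
    g * gcd t m′         ≡⟨ c*gcd[m,n]≡gcd[cm,cn] g t m′ ⟩
    gcd (g * t) (g * m′) ≡⟨ cong₂ gcd (sym d≡gt) (sym m≡gm′) ⟩
    g                    ≡⟨ *-identityʳ g ⟨
    g * 1                ∎))
    where open ≡-Reasoning
  t∣m′k : t ∣ m′ * k
  t∣m′k = *-cancelˡ-∣ g (subst₂ _∣_ d≡gt (trans (cong (_* k) m≡gm′) (*-assoc g m′ k)) d∣mk)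
  t∣gcd[d,k] : t ∣ gcd d k
  t∣gcd[d,k] = gcd-greatest (divides g d≡gt) (coprime-divisor t⊥m′ t∣m′k)

-- Unitary divisors and the unitary gcd

-- Unitary divisibility with the cofactor n / d made explicit, which avoids division.
infix 4 _∥_

_∥_ : ℕ → ℕ → Set
d ∥ n = Σ[ e ∈ ℕ ] (d * e ≡ n × Coprime d e)

∥⇒∣ : ∀ {d n} → d ∥ n → d ∣ n
∥⇒∣ {d} (e , de≡n , _) = divides e (trans (sym de≡n) (*-comm d e))

∥⇒≤ : ∀ {d n} .{{_ : NonZero n}} → d ∥ n → d ≤ n
∥⇒≤ d∥n = ∣⇒≤ (∥⇒∣ d∥n)

∥⇒nonZero : ∀ {d n} .{{_ : NonZero n}} → d ∥ n → NonZero d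
∥⇒nonZero {zero} {n} (e , 0≡n , _) = ⊥-elim (≢-nonZero⁻¹ n (sym 0≡n))
∥⇒nonZero {suc d} _ = _

1∥_ : ∀ n → 1 ∥ n
1∥ n = n , *-identityˡ n , coprime-1ˡ

∥-refl : ∀ {n} → n ∥ n
∥-refl {n} = 1 , *-identityʳ n , coprime-sym coprime-1ˡ

∥⇒UnitaryDivisor : ∀ {d n} .{{_ : NonZero n}} → d ∥ n → UnitaryDivisor d n
∥⇒UnitaryDivisor {zero}  d∥n = ⊥-elim (≢-nonZero⁻¹ 0 {{∥⇒nonZero d∥n}} refl)
∥⇒UnitaryDivisor {suc d} {n} d∥n@(e , de≡n , d⊥e) =
  ∥⇒∣ d∥n , subst (λ c → gcd (suc d) c ≡ 1) (sym n/d≡e) (coprime⇒gcd≡1 d⊥e)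
  where
  n/d≡e : n / suc d ≡ e
  n/d≡e = trans (cong (_/ suc d) (trans (sym de≡n) (*-comm (suc d) e))) (m*n/n≡m e (suc d))

UnitaryDivisor⇒∥ : ∀ {d n} .{{_ : NonZero n}} → UnitaryDivisor d n → d ∥ n
UnitaryDivisor⇒∥ {zero} {n} (divides q n≡q*0 , _) = ⊥-elim (≢-nonZero⁻¹ n (trans n≡q*0 (*-zeroʳ q)))
UnitaryDivisor⇒∥ {suc d} {n} (divides q n≡q*d , gcd≡1) =
  q , trans (*-comm (suc d) q) (sym n≡q*d) , gcd≡1⇒coprime (subst (λ c → gcd (suc d) c ≡ 1) n/d≡q gcd≡1)
  where
  n/d≡q : n / suc d ≡ q
  n/d≡q = trans (cong (_/ suc d) n≡q*d) (m*n/n≡m q (suc d))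

∥p^ν⇒ : ∀ {p d} ν → Prime p → d ∥ p ^ ν → d ≡ 1 ⊎ d ≡ p ^ ν
∥p^ν⇒ {p} {d} ν p-prime (e , de≡p^ν , d⊥e) with d ≟ 1 | e ≟ 1
... | yes d≡1 | _        = inj₁ d≡1
... | no _    | yes refl = inj₂ (trans (sym (*-identityʳ d)) de≡p^ν)
... | no d≢1  | no e≢1   = ⊥-elim (prime≢1 p-prime (d⊥e
      ( ∣p^ν⇒p∣ ν p-prime (divides e (trans (sym de≡p^ν) (*-comm d e))) d≢1
      , ∣p^ν⇒p∣ ν p-prime (divides d (sym de≡p^ν)) e≢1)))

∥-* : ∀ {m k d₁ d₂} → Coprime m k → d₁ ∥ m → d₂ ∥ k → d₁ * d₂ ∥ m * k
∥-* {m} {k} {d₁} {d₂} m⊥k (e₁ , d₁e₁≡m , d₁⊥e₁) (e₂ , d₂e₂≡k , d₂⊥e₂) =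
  e₁ * e₂ , trans (*-interchange d₁ d₂ e₁ e₂) (cong₂ _*_ d₁e₁≡m d₂e₂≡k) ,
  coprime-*ˡ (coprime-*ʳ d₁⊥e₁ (coprime-∣-mono m⊥k d₁∣m e₂∣k))
             (coprime-*ʳ (coprime-∣-mono (coprime-sym m⊥k) d₂∣k e₁∣m) d₂⊥e₂)
  where
  d₁∣m : d₁ ∣ m
  d₁∣m = divides e₁ (trans (sym d₁e₁≡m) (*-comm d₁ e₁))
  e₁∣m : e₁ ∣ m
  e₁∣m = divides d₁ (sym d₁e₁≡m)
  d₂∣k : d₂ ∣ k
  d₂∣k = divides e₂ (trans (sym d₂e₂≡k) (*-comm d₂ e₂))
  e₂∣k : e₂ ∣ k
  e₂∣k = divides d₂ (sym d₂e₂≡k)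

∥-*-split : ∀ {m k d} .{{_ : NonZero (m * k)}} → Coprime m k → d ∥ m * k →
            gcd d m ∥ m × gcd d k ∥ k × d ≡ gcd d m * gcd d k
∥-*-split {m} {k} {d} m⊥k d∥mk@(e , de≡mk , d⊥e) with gcd[m,n]∣n d m | gcd[m,n]∣n d k
... | divides m′ m≡m′d₁ | divides k′ k≡k′d₂ = d₁∥m , d₂∥k , d≡d₁d₂
  where
  instance
    d≢0 : NonZero d
    d≢0 = ∥⇒nonZero d∥mk
  d₁ d₂ : ℕ
  d₁ = gcd d m
  d₂ = gcd d k
  d≡d₁d₂ : d ≡ d₁ * d₂
  d≡d₁d₂ = ∣-antisym (∣*⇒∣gcd*gcd m⊥k (∥⇒∣ d∥mk))
    (coprime⇒*∣ (coprime-∣-mono m⊥k (gcd[m,n]∣n d m) (gcd[m,n]∣n d k)) (gcd[m,n]∣m d m) (gcd[m,n]∣m d k))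
  instance
    d₁d₂≢0 : NonZero (d₁ * d₂)
    d₁d₂≢0 = subst NonZero d≡d₁d₂ d≢0
  e≡m′k′ : e ≡ m′ * k′
  e≡m′k′ = *-cancelˡ-≡ e (m′ * k′) (d₁ * d₂) (begin
    d₁ * d₂ * e         ≡⟨ cong (_* e) d≡d₁d₂ ⟨
    d * e               ≡⟨ de≡mk ⟩
    m * k               ≡⟨ cong₂ _*_ (trans m≡m′d₁ (*-comm m′ d₁)) (trans k≡k′d₂ (*-comm k′ d₂)) ⟩
    d₁ * m′ * (d₂ * k′) ≡⟨ *-interchange d₁ m′ d₂ k′ ⟩
    d₁ * d₂ * (m′ * k′) ∎)
    where open ≡-Reasoning
  d₁∥m : d₁ ∥ m
  d₁∥m = m′ , trans (*-comm d₁ m′) (sym m≡m′d₁) ,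
         coprime-∣-mono d⊥e (gcd[m,n]∣m d m) (divides k′ (trans e≡m′k′ (*-comm m′ k′)))
  d₂∥k : d₂ ∥ k
  d₂∥k = k′ , trans (*-comm d₂ k′) (sym k≡k′d₂) ,
         coprime-∣-mono d⊥e (gcd[m,n]∣m d k) (divides m′ e≡m′k′)

record IsUnitaryGcd (x n u : ℕ) : Set where
  field
    ∣x       : u ∣ x
    ∥n       : u ∥ n
    greatest : ∀ {d} → d ∣ x → d ∥ n → d ≤ u

∈-range1 : ∀ {d} n → 1 ≤ d → d ≤ n → d ∈ range1 n
∈-range1 zero    1≤d d≤0 = ⊥-elim (≤⇒≯ d≤0 1≤d)
∈-range1 {d} (suc n) 1≤d d≤1+n with d ≟ suc n
... | yes refl = ∈-++⁺ʳ (range1 n) (here refl)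
... | no d≢1+n = ∈-++⁺ˡ (∈-range1 n 1≤d (s≤s⁻¹ (≤∧≢⇒< d≤1+n d≢1+n)))

max≥ : ∀ {x} xs → x ∈ xs → x ≤ foldr _⊔_ 0 xs
max≥ xs x∈xs = foldr-preservesᵒ ≤-⊔ 0 xs (inj₂ (Any.map ≤-reflexive x∈xs))
  where
  ≤-⊔ : ∀ {x} a b → x ≤ a ⊎ x ≤ b → x ≤ a ⊔ b
  ≤-⊔ a b (inj₁ x≤a) = m≤n⇒m≤n⊔o b x≤a
  ≤-⊔ a b (inj₂ x≤b) = m≤n⇒m≤o⊔n a x≤b

unitaryGcd-isUnitaryGcd : ∀ x n .{{_ : NonZero n}} → IsUnitaryGcd x n (unitaryGcd x n)
unitaryGcd-isUnitaryGcd x n = record { ∣x = proj₁ u-spec ; ∥n = proj₂ u-spec ; greatest = greatest }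
  where
  candidates : List ℕ
  candidates = filter (λ d → d ∣? x ×-dec unitaryDivisor? d n) (range1 n)
  greatest : ∀ {d} → d ∣ x → d ∥ n → d ≤ unitaryGcd x n
  greatest d∣x d∥n = max≥ candidates
    (∈-filter⁺ _ (∈-range1 n (>-nonZero⁻¹ _ {{∥⇒nonZero d∥n}}) (∥⇒≤ d∥n)) (d∣x , ∥⇒UnitaryDivisor d∥n))
  u-spec : unitaryGcd x n ∣ x × unitaryGcd x n ∥ n
  u-spec with foldr-selective ⊔-sel 0 candidates
  ... | inj₁ u≡0 = ⊥-elim (<-irrefl (sym u≡0) (greatest (1∣ x) (1∥ n)))
  ... | inj₂ u∈ with ∈-filter⁻ _ {xs = range1 n} u∈
  ...   | _ , u∣x , u-unitary = u∣x , UnitaryDivisor⇒∥ u-unitary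

isUnitaryGcd⇒≡ : ∀ {x n u} .{{_ : NonZero n}} → IsUnitaryGcd x n u → unitaryGcd x n ≡ u
isUnitaryGcd⇒≡ {x} {n} u-spec = ≤-antisym (U.greatest V.∣x V.∥n) (V.greatest U.∣x U.∥n)
  where
  module U = IsUnitaryGcd u-spec
  module V = IsUnitaryGcd (unitaryGcd-isUnitaryGcd x n)

unitaryGcd-periodic : ∀ x n .{{_ : NonZero n}} → unitaryGcd (x + n) n ≡ unitaryGcd x n
unitaryGcd-periodic x n = isUnitaryGcd⇒≡ record
  { ∣x       = ∣m∣n⇒∣m+n U.∣x (∥⇒∣ U.∥n)
  ; ∥n       = U.∥n
  ; greatest = greatest
  }
  where
  module U = IsUnitaryGcd (unitaryGcd-isUnitaryGcd x n)
  greatest : ∀ {d} → d ∣ x + n → d ∥ n → d ≤ unitaryGcd x n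
  greatest {d} d∣x+n d∥n = U.greatest (∣m+n∣m⇒∣n (subst (d ∣_) (+-comm x n) d∣x+n) (∥⇒∣ d∥n)) d∥n

unitaryGcd-* : ∀ x m k .{{_ : NonZero m}} .{{_ : NonZero k}} → Coprime m k →
               unitaryGcd x (m * k) ≡ unitaryGcd x m * unitaryGcd x k
unitaryGcd-* x m k m⊥k = isUnitaryGcd⇒≡ {{m*n≢0 m k}} record
  { ∣x       = coprime⇒*∣ (coprime-∣-mono m⊥k (∥⇒∣ U.∥n) (∥⇒∣ V.∥n)) U.∣x V.∣x
  ; ∥n       = ∥-* m⊥k U.∥n V.∥n
  ; greatest = greatest
  }
  where
  module U = IsUnitaryGcd (unitaryGcd-isUnitaryGcd x m)
  module V = IsUnitaryGcd (unitaryGcd-isUnitaryGcd x k)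
  greatest : ∀ {d} → d ∣ x → d ∥ m * k → d ≤ unitaryGcd x m * unitaryGcd x k
  greatest {d} d∣x d∥mk with ∥-*-split {{m*n≢0 m k}} m⊥k d∥mk
  ... | d₁∥m , d₂∥k , d≡d₁d₂ = subst (_≤ unitaryGcd x m * unitaryGcd x k) (sym d≡d₁d₂)
    (*-mono-≤ (U.greatest (∣-trans (gcd[m,n]∣m d m) d∣x) d₁∥m)
              (V.greatest (∣-trans (gcd[m,n]∣m d k) d∣x) d₂∥k))

unitaryGcd[0,n]≡n : ∀ n .{{_ : NonZero n}} → unitaryGcd 0 n ≡ n
unitaryGcd[0,n]≡n n = isUnitaryGcd⇒≡ record { ∣x = n ∣0 ; ∥n = ∥-refl ; greatest = λ _ → ∥⇒≤ }

unitaryGcd[x,p^ν]≡1 : ∀ {p} ν x → Prime p → 0 < x → x < p ^ ν → unitaryGcd x (p ^ ν) ≡ 1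
unitaryGcd[x,p^ν]≡1 {p} ν x p-prime 0<x x<p^ν = isUnitaryGcd⇒≡ {{p^ν≢0}} record
  { ∣x = 1∣ x ; ∥n = 1∥ (p ^ ν) ; greatest = greatest }
  where
  instance
    p^ν≢0 : NonZero (p ^ ν)
    p^ν≢0 = m^n≢0 p ν {{prime⇒nonZero p-prime}}
  greatest : ∀ {d} → d ∣ x → d ∥ p ^ ν → d ≤ 1
  greatest d∣x d∥p^ν with ∥p^ν⇒ ν p-prime d∥p^ν
  ... | inj₁ refl = ≤-refl
  ... | inj₂ refl = ⊥-elim (<⇒≱ x<p^ν (∣⇒≤ {{>-nonZero 0<x}} d∣x))

-- The left-hand side

-- The summand of lhs n at a = i + 1.
lhsTerm : ℕ → ℕ → ℕ
lhsTerm n i = indicator (gcd (suc i) n ≟ 1) * unitaryGcd i n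

lhs≡∑ : ∀ n → lhs n ≡ ∑ n (lhsTerm n)
lhs≡∑ n = sum-filter-range1 (λ a → gcd a n ≟ 1) (λ a → unitaryGcd (a ∸ 1) n) n

indicator-coprime-* : ∀ a m k →
                      indicator (gcd a (m * k) ≟ 1) ≡ indicator (gcd a m ≟ 1) * indicator (gcd a k ≟ 1)
indicator-coprime-* a m k with gcd a m ≟ 1 | gcd a k ≟ 1
... | yes a⊥m | yes a⊥k = indicator-yes
                            (coprime⇒gcd≡1 {a} (coprime-*ʳ (gcd≡1⇒coprime {a} a⊥m) (gcd≡1⇒coprime {a} a⊥k))) _
... | no ¬a⊥m | _       = indicator-no (λ a⊥mk → ¬a⊥m (coprime⇒gcd≡1 {a}
                            (coprime-∣-mono (gcd≡1⇒coprime {a} a⊥mk) ∣-refl (m∣m*n k)))) _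
... | yes _   | no ¬a⊥k = indicator-no (λ a⊥mk → ¬a⊥k (coprime⇒gcd≡1 {a}
                            (coprime-∣-mono (gcd≡1⇒coprime {a} a⊥mk) ∣-refl (n∣m*n m)))) _

indicator-coprime-+ : ∀ a n → indicator (gcd (a + n) n ≟ 1) ≡ indicator (gcd a n ≟ 1)
indicator-coprime-+ a n = indicator-cong
  (λ a+n⊥n → coprime⇒gcd≡1 {a} (λ (i∣a , i∣n) → gcd≡1⇒coprime {a + n} a+n⊥n (∣m∣n⇒∣m+n i∣a i∣n , i∣n)))
  (λ a⊥n → coprime⇒gcd≡1 {a + n} (λ {i} (i∣a+n , i∣n) →
     gcd≡1⇒coprime {a} a⊥n (∣m+n∣m⇒∣n (subst (i ∣_) (+-comm a n) i∣a+n) i∣n , i∣n)))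
  (gcd (a + n) n ≟ 1) (gcd a n ≟ 1)

lhsTerm-* : ∀ m k i .{{_ : NonZero m}} .{{_ : NonZero k}} → Coprime m k →
            lhsTerm (m * k) i ≡ lhsTerm m i * lhsTerm k i
lhsTerm-* m k i m⊥k = trans
  (cong₂ _*_ (indicator-coprime-* (suc i) m k) (unitaryGcd-* i m k m⊥k))
  (*-interchange (indicator (gcd (suc i) m ≟ 1)) (indicator (gcd (suc i) k ≟ 1))
                 (unitaryGcd i m) (unitaryGcd i k))

lhsTerm-periodic : ∀ n .{{_ : NonZero n}} → Periodic (lhsTerm n) n
lhsTerm-periodic n i = cong₂ _*_ (indicator-coprime-+ (suc i) n) (unitaryGcd-periodic i n)

lhs-* : ∀ m k .{{_ : NonZero m}} .{{_ : NonZero k}} → Coprime m k → lhs (m * k) ≡ lhs m * lhs k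
lhs-* m k m⊥k = begin
  lhs (m * k)
    ≡⟨ lhs≡∑ (m * k) ⟩
  ∑ (m * k) (lhsTerm (m * k))
    ≡⟨ ∑-cong (m * k) (λ i _ → lhsTerm-* m k i m⊥k) ⟩
  ∑ (m * k) (λ i → lhsTerm m i * lhsTerm k i)
    ≡⟨ cong (λ n → ∑ n (λ i → lhsTerm m i * lhsTerm k i)) (*-comm m k) ⟩
  ∑ (k * m) (λ i → lhsTerm m i * lhsTerm k i)
    ≡⟨ ∑-*-periodic m k m⊥k (lhsTerm-periodic m) (lhsTerm-periodic k) ⟩
  ∑ m (lhsTerm m) * ∑ k (lhsTerm k)
    ≡⟨ cong₂ _*_ (lhs≡∑ m) (lhs≡∑ k) ⟨
  lhs m * lhs k
    ∎
  where open ≡-Reasoning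

rhsFactor : ℕ → ℕ → ℕ
rhsFactor p ν = 2 * p ^ ν ∸ p ^ (ν ∸ 1) ∸ 1

χ : ℕ → ℕ → ℕ
χ p x = indicator (¬? (p ∣? x))

χ-periodic : ∀ p → Periodic (χ p) p
χ-periodic p x = indicator-cong (λ p∤x+p p∣x → p∤x+p (∣m∣n⇒∣m+n p∣x ∣-refl))
                                (λ p∤x p∣x+p → p∤x (∣m+n∣m⇒∣n (subst (p ∣_) (+-comm x p) p∣x+p) ∣-refl))
                                (¬? (p ∣? x + p)) (¬? (p ∣? x))

χ[0]≡0 : ∀ p → χ p 0 ≡ 0
χ[0]≡0 p = indicator-no (λ p∤0 → p∤0 (p ∣0)) (¬? (p ∣? 0))

χ[x]≡1 : ∀ p x .{{_ : NonZero x}} → x < p → χ p x ≡ 1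
χ[x]≡1 p x x<p = indicator-yes (λ p∣x → <⇒≱ x<p (∣⇒≤ p∣x)) (¬? (p ∣? x))

∑χ[p] : ∀ p .{{_ : NonZero p}} → ∑ p (χ p) ≡ p ∸ 1
∑χ[p] p = begin
  ∑ p (χ p)                              ≡⟨ ∑-head′ p (χ p) ⟩
  χ p 0 + ∑ (p ∸ 1) (λ i → χ p (suc i))  ≡⟨ cong₂ _+_ (χ[0]≡0 p) (∑-cong (p ∸ 1) (λ i i<p-1 →
                                              χ[x]≡1 p (suc i) (<∸1⇒1+< p i<p-1))) ⟩
  ∑ (p ∸ 1) (λ _ → 1)                    ≡⟨ ∑-const (p ∸ 1) 1 ⟩
  (p ∸ 1) * 1                            ≡⟨ *-identityʳ (p ∸ 1) ⟩
  p ∸ 1                                  ∎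
  where open ≡-Reasoning

indicator-coprime-p^ν : ∀ {p} a ν → Prime p → indicator (gcd a (p ^ suc ν) ≟ 1) ≡ χ p a
indicator-coprime-p^ν {p} a ν p-prime = indicator-cong
  (λ a⊥p^ν p∣a → prime≢1 p-prime (gcd≡1⇒coprime {a} a⊥p^ν (p∣a , m∣m*n (p ^ ν))))
  (λ p∤a → coprime⇒gcd≡1 {a} (coprime-^ʳ (suc ν) (coprime-sym (prime∤⇒coprime p-prime p∤a))))
  (gcd a (p ^ suc ν) ≟ 1) (¬? (p ∣? a))

lhsTerm-p^ν : ∀ {p} ν i → Prime p → 0 < i → i < p ^ suc ν → lhsTerm (p ^ suc ν) i ≡ χ p (suc i)
lhsTerm-p^ν ν i p-prime 0<i i<p^ν = trans
  (cong₂ _*_ (indicator-coprime-p^ν (suc i) ν p-prime) (unitaryGcd[x,p^ν]≡1 (suc ν) i p-prime 0<i i<p^ν))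
  (*-identityʳ _)

1+s≡m*[p∸1]⇒p*m+s≡2*[p*m]∸m∸1 : ∀ p m s → 1 ≤ p → suc s ≡ m * (p ∸ 1) →
                                 p * m + s ≡ 2 * (p * m) ∸ m ∸ 1
1+s≡m*[p∸1]⇒p*m+s≡2*[p*m]∸m∸1 (suc q) m s _ 1+s≡mq = begin
  suc q * m + s                   ≡⟨ cong (_∸ 1) (+-suc (suc q * m) s) ⟨
  (suc q * m + suc s) ∸ 1         ≡⟨ cong (λ t → (suc q * m + t) ∸ 1) 1+s≡mq ⟩
  (suc q * m + m * q) ∸ 1         ≡⟨ cong (_∸ 1) (m+n∸n≡m (suc q * m + m * q) m) ⟨
  (suc q * m + m * q + m) ∸ m ∸ 1 ≡⟨ cong (λ t → t ∸ m ∸ 1) (solve 2 (λ q m → (con 1 :+ q) :* m :+ m :* q :+ m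
                                                                      := con 2 :* ((con 1 :+ q) :* m)) refl q m) ⟩
  2 * (suc q * m) ∸ m ∸ 1         ∎
  where
  open ≡-Reasoning
  open +-*-Solver

-- a = 1 contributes (0, p^ν)_* = p^ν; every other a prime to p contributes (a - 1, p^ν)_* = 1.
lhs-p^ν : ∀ {p} ν → Prime p → lhs (p ^ suc ν) ≡ rhsFactor p (suc ν)
lhs-p^ν {p} ν p-prime = begin
  lhs N
    ≡⟨ lhs≡∑ N ⟩
  ∑ N (lhsTerm N)
    ≡⟨ ∑-head′ N (lhsTerm N) ⟩
  lhsTerm N 0 + ∑ (N ∸ 1) (λ i → lhsTerm N (suc i))
    ≡⟨ cong₂ _+_ lhsTerm[0] (∑-cong (N ∸ 1) (λ i i<N-1 → lhsTerm-p^ν ν (suc i) p-prime z<s (<∸1⇒1+< N i<N-1))) ⟩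
  N + S
    ≡⟨ 1+s≡m*[p∸1]⇒p*m+s≡2*[p*m]∸m∸1 p M S 1≤p 1+S≡M*[p∸1] ⟩
  rhsFactor p (suc ν)
    ∎
  where
  open ≡-Reasoning
  instance
    p≢0 : NonZero p
    p≢0 = prime⇒nonZero p-prime
    N≢0 : NonZero (p ^ suc ν)
    N≢0 = m^n≢0 p (suc ν)
  1≤p : 1 ≤ p
  1≤p = <⇒≤ (prime>1 p-prime)
  M N S : ℕ
  M = p ^ ν
  N = p * M
  S = ∑ (N ∸ 1) (λ i → χ p (2 + i))
  lhsTerm[0] : lhsTerm N 0 ≡ N
  lhsTerm[0] = trans (cong₂ _*_ (indicator-yes (gcd-zeroˡ N) (gcd 1 N ≟ 1)) (unitaryGcd[0,n]≡n N)) (*-identityˡ N)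
  χ[N]≡0 : χ p N ≡ 0
  χ[N]≡0 = indicator-no (λ p∤N → p∤N (m∣m*n M)) (¬? (p ∣? N))
  ∑χ-shift : ∑ N (λ i → χ p (suc i)) ≡ ∑ N (χ p)
  ∑χ-shift = begin
    ∑ N (λ i → χ p (suc i))           ≡⟨ +-identityʳ _ ⟨
    ∑ N (λ i → χ p (suc i)) + 0       ≡⟨ cong (∑ N (λ i → χ p (suc i)) +_) (χ[0]≡0 p) ⟨
    ∑ N (λ i → χ p (suc i)) + χ p 0   ≡⟨ ∑-rotate N (χ p) ⟩
    ∑ N (χ p) + χ p N                 ≡⟨ cong (∑ N (χ p) +_) χ[N]≡0 ⟩
    ∑ N (χ p) + 0                     ≡⟨ +-identityʳ _ ⟩
    ∑ N (χ p)                         ∎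
  1+S≡M*[p∸1] : suc S ≡ M * (p ∸ 1)
  1+S≡M*[p∸1] = begin
    suc S                      ≡⟨ cong (_+ S) (χ[x]≡1 p 1 (prime>1 p-prime)) ⟨
    χ p 1 + S                  ≡⟨ ∑-head′ N (λ i → χ p (suc i)) ⟨
    ∑ N (λ i → χ p (suc i))    ≡⟨ ∑χ-shift ⟩
    ∑ N (χ p)                  ≡⟨ cong (λ n → ∑ n (χ p)) (*-comm p M) ⟩
    ∑ (M * p) (χ p)            ≡⟨ ∑-periodic p M (χ-periodic p) ⟩
    M * ∑ p (χ p)              ≡⟨ cong (M *_) (∑χ[p] p) ⟩
    M * (p ∸ 1)                ∎

-- The right-hand side

ExactPower : ℕ → ℕ → ℕ → Set
ExactPower q ν n = q ^ ν ∣ n × ¬ q ^ suc ν ∣ n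

exactPower? : ∀ q ν n → Dec (ExactPower q ν n)
exactPower? q ν n = q ^ ν ∣? n ×-dec ¬? (q ^ suc ν ∣? n)

localFactor : ℕ → ℕ → ℕ
localFactor n q = ∏ n (λ j → rhsFactor q (suc j) ^ indicator (exactPower? q (suc j) n))

primeLocalFactor : ℕ → ℕ → ℕ
primeLocalFactor n q = localFactor n q ^ indicator (prime? q)

primeLocalFactor-prime : ∀ n {q} → Prime q → primeLocalFactor n q ≡ localFactor n q
primeLocalFactor-prime n {q} q-prime = trans (cong (localFactor n q ^_) (indicator-yes q-prime (prime? q))) (^-identityʳ _)

primeLocalFactor-¬prime : ∀ n {q} → ¬ Prime q → primeLocalFactor n q ≡ 1
primeLocalFactor-¬prime n {q} ¬q-prime = cong (localFactor n q ^_) (indicator-no ¬q-prime (prime? q))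

rhs≡∏ : ∀ n → rhs n ≡ ∏ n (λ i → primeLocalFactor n (suc i))
rhs≡∏ n = begin
  rhs n                                                     ≡⟨ product-concatMap factor exponents primes ⟩
  product (map (λ p → product (map factor (exponents p))) primes) ≡⟨ cong product (map-cong local primes) ⟩
  product (map (localFactor n) primes)                      ≡⟨ product-filter-range1 prime? (localFactor n) n ⟩
  ∏ n (λ i → primeLocalFactor n (suc i))                    ∎
  where
  open ≡-Reasoning
  primes : List ℕ
  primes = filter prime? (range1 n)
  factor : ℕ × ℕ → ℕ
  factor (p , ν) = rhsFactor p ν
  exponents : ℕ → List (ℕ × ℕ)
  exponents p = map (p ,_) (filter (λ ν → exactPower? p ν n) (range1 n))
  local : ∀ p → product (map factor (exponents p)) ≡ localFactor n p
  local p = trans (cong product (sym (map-∘ (filter (λ ν → exactPower? p ν n) (range1 n)))))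
                  (product-filter-range1 (λ ν → exactPower? p ν n) (rhsFactor p) n)

exactPower-unique : ∀ {q n a b} → ExactPower q a n → ExactPower q b n → a ≡ b
exactPower-unique {q} {n} {a} {b} (q^a∣n , q^1+a∤n) (q^b∣n , q^1+b∤n) with <-cmp a b
... | tri< a<b _ _ = ⊥-elim (q^1+a∤n (∣-trans (^-monoʳ-∣ q a<b) q^b∣n))
... | tri≈ _ a≡b _ = a≡b
... | tri> _ _ b<a = ⊥-elim (q^1+b∤n (∣-trans (^-monoʳ-∣ q b<a) q^a∣n))

exactPower-*-coprime : ∀ {q P m a} → Coprime q P → ExactPower q a (P * m) → ExactPower q a m
exactPower-*-coprime {q} {P} {m} {a} q⊥P (q^a∣Pm , q^1+a∤Pm) =
  coprime-divisor (coprime-^ˡ a q⊥P) q^a∣Pm , λ q^1+a∣m → q^1+a∤Pm (∣n⇒∣m*n P q^1+a∣m)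

*-coprime-exactPower : ∀ {q P m a} → Coprime q P → ExactPower q a m → ExactPower q a (P * m)
*-coprime-exactPower {q} {P} {m} {a} q⊥P (q^a∣m , q^1+a∤m) =
  ∣n⇒∣m*n P q^a∣m , λ q^1+a∣Pm → q^1+a∤m (coprime-divisor (coprime-^ˡ (suc a) q⊥P) q^1+a∣Pm)

localFactor-∤ : ∀ n q → ¬ q ∣ n → localFactor n q ≡ 1
localFactor-∤ n q q∤n = ∏-ones n _ (λ j _ → cong (rhsFactor q (suc j) ^_)
  (indicator-no (λ (q^1+j∣n , _) → q∤n (∣-trans (m∣m*n (q ^ j)) q^1+j∣n)) (exactPower? q (suc j) n)))

localFactor-exact : ∀ n q μ .{{_ : NonZero n}} → 1 < q → ExactPower q (suc μ) n →
                    localFactor n q ≡ rhsFactor q (suc μ)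
localFactor-exact n q μ 1<q q^1+μ∥n = trans
  (∏-single n _ μ μ<n others)
  (trans (cong (rhsFactor q (suc μ) ^_) (indicator-yes q^1+μ∥n (exactPower? q (suc μ) n))) (^-identityʳ _))
  where
  μ<n : μ < n
  μ<n = <-trans (n<1+n μ) (<-≤-trans (n<m^n (suc μ) 1<q) (∣⇒≤ (proj₁ q^1+μ∥n)))
  others : ∀ j → j < n → j ≢ μ → rhsFactor q (suc j) ^ indicator (exactPower? q (suc j) n) ≡ 1
  others j _ j≢μ = cong (rhsFactor q (suc j) ^_)
    (indicator-no (λ q^1+j∥n → j≢μ (suc-injective (exactPower-unique {q} q^1+j∥n q^1+μ∥n)))
                  (exactPower? q (suc j) n))

localFactor-*-coprime : ∀ P m q .{{_ : NonZero P}} .{{_ : NonZero m}} → 1 < q → Coprime q P →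
                        localFactor (P * m) q ≡ localFactor m q
localFactor-*-coprime P m q 1<q q⊥P = begin
  ∏ (P * m) (factor (P * m))  ≡⟨ ∏-cong (P * m) (λ j _ → cong (rhsFactor q (suc j) ^_) (exact⇔ (suc j))) ⟩
  ∏ (P * m) (factor m)        ≡⟨ ∏-extend (P * m) (factor m) (m≤n*m m P) beyond-m ⟩
  ∏ m (factor m)              ∎
  where
  open ≡-Reasoning
  factor : ℕ → ℕ → ℕ
  factor n j = rhsFactor q (suc j) ^ indicator (exactPower? q (suc j) n)
  exact⇔ : ∀ a → indicator (exactPower? q a (P * m)) ≡ indicator (exactPower? q a m)
  exact⇔ a = indicator-cong (exactPower-*-coprime {a = a} q⊥P) (*-coprime-exactPower {a = a} q⊥P)
                            (exactPower? q a (P * m)) (exactPower? q a m)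
  beyond-m : ∀ j → m ≤ j → j < P * m → factor m j ≡ 1
  beyond-m j m≤j _ = cong (rhsFactor q (suc j) ^_) (indicator-no
    (λ (q^1+j∣m , _) → <⇒≱ (<-trans (s≤s m≤j) (n<m^n (suc j) 1<q)) (∣⇒≤ q^1+j∣m)) (exactPower? q (suc j) m))

∏-^-indicator-≟ : ∀ n c p .{{_ : NonZero p}} → p ≤ n → ∏ n (λ i → c ^ indicator (suc i ≟ p)) ≡ c
∏-^-indicator-≟ n c p p≤n = trans
  (∏-single n (λ i → c ^ indicator (suc i ≟ p)) (pred p) pred[p]<n others)
  (trans (cong (c ^_) (indicator-yes (suc-pred p) (suc (pred p) ≟ p))) (^-identityʳ c))
  where
  pred[p]<n : pred p < n
  pred[p]<n = <-≤-trans (subst (pred p <_) (suc-pred p) ≤-refl) p≤n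
  others : ∀ i → i < n → i ≢ pred p → c ^ indicator (suc i ≟ p) ≡ 1
  others i _ i≢pred[p] = cong (c ^_) (indicator-no (λ 1+i≡p → i≢pred[p] (cong pred 1+i≡p)) (suc i ≟ p))

rhs≡∏-≥ : ∀ m n .{{_ : NonZero m}} → m ≤ n → rhs m ≡ ∏ n (λ i → primeLocalFactor m (suc i))
rhs≡∏-≥ m n m≤n = begin
  rhs m                                   ≡⟨ rhs≡∏ m ⟩
  ∏ m (λ i → primeLocalFactor m (suc i))  ≡⟨ ∏-extend n (λ i → primeLocalFactor m (suc i)) m≤n beyond-m ⟨
  ∏ n (λ i → primeLocalFactor m (suc i))  ∎
  where
  open ≡-Reasoning
  beyond-m : ∀ i → m ≤ i → i < n → primeLocalFactor m (suc i) ≡ 1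
  beyond-m i m≤i _ = trans
    (cong (_^ indicator (prime? (suc i))) (localFactor-∤ m (suc i) (λ 1+i∣m → <⇒≱ (s≤s m≤i) (∣⇒≤ 1+i∣m))))
    (^-zeroˡ (indicator (prime? (suc i))))

exactPower-p^ν* : ∀ {p m} ν .{{_ : NonZero p}} → ¬ p ∣ m → ExactPower p ν (p ^ ν * m)
exactPower-p^ν* {p} {m} ν p∤m = m∣m*n m , λ p^1+ν∣p^ν*m →
  p∤m (*-cancelˡ-∣ (p ^ ν) {{m^n≢0 p ν}} (subst (_∣ p ^ ν * m) (*-comm p (p ^ ν)) p^1+ν∣p^ν*m))

primeLocalFactor-p^ν* : ∀ {p} ν m q .{{_ : NonZero m}} → Prime p → ¬ p ∣ m →
  primeLocalFactor (p ^ suc ν * m) q ≡ rhsFactor p (suc ν) ^ indicator (q ≟ p) * primeLocalFactor m q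
primeLocalFactor-p^ν* {p} ν m q p-prime p∤m = by-cases (prime? q) (q ≟ p)
  where
  open ≡-Reasoning
  instance
    p≢0 : NonZero p
    p≢0 = prime⇒nonZero p-prime
    P≢0 : NonZero (p ^ suc ν)
    P≢0 = m^n≢0 p (suc ν)
    n≢0 : NonZero (p ^ suc ν * m)
    n≢0 = m*n≢0 (p ^ suc ν) m
  n : ℕ
  n = p ^ suc ν * m
  atP : ℕ → ℕ
  atP q = rhsFactor p (suc ν) ^ indicator (q ≟ p)
  atP[q≢p] : ∀ {q} → q ≢ p → atP q ≡ 1
  atP[q≢p] {q} q≢p = cong (rhsFactor p (suc ν) ^_) (indicator-no q≢p (q ≟ p))
  by-cases : Dec (Prime q) → Dec (q ≡ p) → primeLocalFactor n q ≡ atP q * primeLocalFactor m q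
  by-cases (no ¬q-prime) (yes refl) = ⊥-elim (¬q-prime p-prime)
  by-cases (no ¬q-prime) (no q≢p)   = begin
    primeLocalFactor n q          ≡⟨ primeLocalFactor-¬prime n ¬q-prime ⟩
    1                             ≡⟨ cong₂ _*_ (atP[q≢p] q≢p) (primeLocalFactor-¬prime m ¬q-prime) ⟨
    atP q * primeLocalFactor m q  ∎
  by-cases (yes q-prime) (no q≢p)   = begin
    primeLocalFactor n q          ≡⟨ primeLocalFactor-prime n q-prime ⟩
    localFactor n q               ≡⟨ localFactor-*-coprime (p ^ suc ν) m q (prime>1 q-prime) q⊥P ⟩
    localFactor m q               ≡⟨ primeLocalFactor-prime m q-prime ⟨
    primeLocalFactor m q          ≡⟨ *-identityˡ _ ⟨
    1 * primeLocalFactor m q      ≡⟨ cong (_* primeLocalFactor m q) (atP[q≢p] q≢p) ⟨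
    atP q * primeLocalFactor m q  ∎
    where
    q⊥P : Coprime q (p ^ suc ν)
    q⊥P = coprime-^ʳ (suc ν) (primes-coprime q-prime p-prime q≢p)
  by-cases (yes _)       (yes refl) = begin
    primeLocalFactor n p          ≡⟨ primeLocalFactor-prime n p-prime ⟩
    localFactor n p               ≡⟨ localFactor-exact n p ν (prime>1 p-prime) (exactPower-p^ν* (suc ν) p∤m) ⟩
    rhsFactor p (suc ν)           ≡⟨ *-identityʳ _ ⟨
    rhsFactor p (suc ν) * 1       ≡⟨ cong₂ _*_ atP[p] (trans (primeLocalFactor-prime m p-prime)
                                                             (localFactor-∤ m p p∤m)) ⟨
    atP p * primeLocalFactor m p  ∎
    where
    atP[p] : atP p ≡ rhsFactor p (suc ν)
    atP[p] = trans (cong (rhsFactor p (suc ν) ^_) (indicator-yes refl (p ≟ p))) (^-identityʳ (rhsFactor p (suc ν)))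

rhs-p^ν* : ∀ {p} ν m .{{_ : NonZero m}} → Prime p → ¬ p ∣ m →
           rhs (p ^ suc ν * m) ≡ rhsFactor p (suc ν) * rhs m
rhs-p^ν* {p} ν m p-prime p∤m = begin
  rhs n
    ≡⟨ rhs≡∏ n ⟩
  ∏ n (λ i → primeLocalFactor n (suc i))
    ≡⟨ ∏-cong n (λ i _ → primeLocalFactor-p^ν* ν m (suc i) p-prime p∤m) ⟩
  ∏ n (λ i → atP (suc i) * primeLocalFactor m (suc i))
    ≡⟨ ∏-distrib-* n (λ i → atP (suc i)) (λ i → primeLocalFactor m (suc i)) ⟩
  ∏ n (λ i → atP (suc i)) * ∏ n (λ i → primeLocalFactor m (suc i))
    ≡⟨ cong₂ _*_ (∏-^-indicator-≟ n (rhsFactor p (suc ν)) p p≤n) (sym (rhs≡∏-≥ m n m≤n)) ⟩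
  rhsFactor p (suc ν) * rhs m
    ∎
  where
  open ≡-Reasoning
  instance
    p≢0 : NonZero p
    p≢0 = prime⇒nonZero p-prime
    P≢0 : NonZero (p ^ suc ν)
    P≢0 = m^n≢0 p (suc ν)
    n≢0 : NonZero (p ^ suc ν * m)
    n≢0 = m*n≢0 (p ^ suc ν) m
  n : ℕ
  n = p ^ suc ν * m
  atP : ℕ → ℕ
  atP q = rhsFactor p (suc ν) ^ indicator (q ≟ p)
  p≤n : p ≤ n
  p≤n = ∣⇒≤ (∣-trans (m∣m*n (p ^ ν)) (m∣m*n m))
  m≤n : m ≤ n
  m≤n = m≤n*m m (p ^ suc ν)

PrimePowerSplit : ℕ → ℕ → Set
PrimePowerSplit p n = Σ[ ν ∈ ℕ ] Σ[ m ∈ ℕ ] (n ≡ p ^ ν * m × ¬ p ∣ m)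

splitPrimePower : ∀ {p} n → Prime p → 0 < n → PrimePowerSplit p n
splitPrimePower {p} n p-prime = <-rec (λ n → 0 < n → PrimePowerSplit p n) step n
  where
  step : ∀ n → (∀ {k} → k < n → 0 < k → PrimePowerSplit p k) → 0 < n → PrimePowerSplit p n
  step n rec 0<n with p ∣? n
  ... | no p∤n = 0 , n , sym (+-identityʳ n) , p∤n
  ... | yes (divides q n≡q*p) = lift (rec q<n 0<q)
    where
    0<q : 0 < q
    0<q = n≢0⇒n>0 (λ q≡0 → <⇒≢ 0<n (sym (trans n≡q*p (cong (_* p) q≡0))))
    q<n : q < n
    q<n = subst (q <_) (sym n≡q*p) (m<m*n q p {{>-nonZero 0<q}} (prime>1 p-prime))
    lift : PrimePowerSplit p q → PrimePowerSplit p n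
    lift (ν , m , q≡p^ν*m , p∤m) = suc ν , m , n≡p^1+ν*m , p∤m
      where
      n≡p^1+ν*m : n ≡ p ^ suc ν * m
      n≡p^1+ν*m = begin
        n               ≡⟨ n≡q*p ⟩
        q * p           ≡⟨ cong (_* p) q≡p^ν*m ⟩
        p ^ ν * m * p   ≡⟨ *-comm (p ^ ν * m) p ⟩
        p * (p ^ ν * m) ≡⟨ *-assoc p (p ^ ν) m ⟨
        p ^ suc ν * m   ∎
        where open ≡-Reasoning

∃prime∣ : ∀ n → 1 < n → Σ[ p ∈ ℕ ] (Prime p × p ∣ n)
∃prime∣ n 1<n with factorise n {{>-nonZero (<-trans z<s 1<n)}}
... | record { factors = [] ; isFactorisation = n≡1 } = ⊥-elim (<-irrefl (sym n≡1) 1<n)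
... | record { factors = p ∷ ps ; isFactorisation = n≡p*ps ; factorsPrime = p-prime ∷ _ } =
  p , p-prime , divides (product ps) (trans n≡p*ps (*-comm p (product ps)))

mainTheorem9 : (n : ℕ) → 1 ≤ n → lhs n ≡ rhs n
mainTheorem9 = <-rec (λ n → 1 ≤ n → lhs n ≡ rhs n) step
  where
  step : ∀ n → (∀ {k} → k < n → 1 ≤ k → lhs k ≡ rhs k) → 1 ≤ n → lhs n ≡ rhs n
  step 1 _ _ = refl
  step n@(suc (suc _)) ih 1≤n with ∃prime∣ n (s<s z<s)
  ... | p , p-prime , p∣n with splitPrimePower n p-prime 1≤n
  ...   | zero  , m , n≡1*m , p∤m = ⊥-elim (p∤m (subst (p ∣_) (trans n≡1*m (*-identityˡ m)) p∣n))
  ...   | suc ν , m , n≡P*m , p∤m = begin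
    lhs n                       ≡⟨ cong lhs n≡P*m ⟩
    lhs (P * m)                 ≡⟨ lhs-* P m (coprime-^ˡ (suc ν) (prime∤⇒coprime p-prime p∤m)) ⟩
    lhs P * lhs m               ≡⟨ cong₂ _*_ (lhs-p^ν ν p-prime) (ih m<n (>-nonZero⁻¹ m)) ⟩
    rhsFactor p (suc ν) * rhs m ≡⟨ rhs-p^ν* ν m p-prime p∤m ⟨
    rhs (P * m)                 ≡⟨ cong rhs n≡P*m ⟨
    rhs n                       ∎
    where
    open ≡-Reasoning
    P : ℕ
    P = p ^ suc ν
    instance
      p≢0 : NonZero p
      p≢0 = prime⇒nonZero p-prime
      P≢0 : NonZero P
      P≢0 = m^n≢0 p (suc ν)
      m≢0 : NonZero m
      m≢0 = ≢-nonZero (λ m≡0 → p∤m (subst (p ∣_) (sym m≡0) (p ∣0)))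
    m<n : m < n
    m<n = subst (m <_) (trans (*-comm m P) (sym n≡P*m))
                (m<m*n m P (<-≤-trans (prime>1 p-prime) (m≤m*n p (p ^ ν) {{m^n≢0 p ν}})))
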